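{- For every $k\in\mathbb{N}$ (with $k\ge1$) and $\tau_0:=(1,0,\dots,0)\in\mathbb{G}_k$ we have $j_k(\tau_0)>0$ and $j_k(\tau_0)\ge j_k(\tau)$ for all $\tau\in\mathbb{G}_k$.
   Context: For $k\in\mathbb{N}$ let $\mathbb{G}_k=(\mathbb{Z}/2\mathbb{Z})^k$ with $\sigma\cdot\tau=\sum_{i=1}^k\sigma_i\tau_i$. Define $\hat h_k,\hat r_k:\{0,\dots,2^k\}\to\mathbb{N}_0$ recursively by $\hat h_0(0)=\hat h_0(1)=1$, $\hat r_0(0)=0$, $\hat r_0(1)=1$, and for $s\in\{0,\dots,2^k\}$: $\hat h_{k+1}(2s)=\hat h_k(s)$, $\hat r_{k+1}(2s)=\hat r_k(s)$; for $s\in\{0,\dots,2^k-1\}$: $\hat h_{k+1}(2s+1)=\hat h_k(s)+\hat h_k(s+1)$, $\hat r_{k+1}(2s+1)=\hat r_k(s)+\hat r_k(s+1)$. The Farey function is $F_k(\sigma)=\hat r_k(s)/\hat h_k(s)$ with $s=\sum_{i=1}^k\sigma_i2^{k-i}$, and $j_k(\tau)=-2^{ -k}\sum_{\sigma\in\mathbb{G}_k}(-1)^{\sigma\cdot\tau}F_k(\sigma)$ for $\tau\in\mathbb{G}_k$. -}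

module Defs where

open import Data.Nat as ℕ using (ℕ; zero; suc; _+_; _*_; _^_; NonZero)
import Data.Nat.Properties as ℕP
open import Data.Bool using (Bool; true; false)
open import Data.Vec using (Vec; []; _∷_; replicate)
open import Data.List using (List; []; _∷_; map; _++_)
open import Data.Integer as ℤ using (ℤ; +_)
open import Data.Rational as ℚ using (ℚ; _/_; 0ℚ)
open import Relation.Binary.PropositionalEquality using (_≡_; refl; subst; cong)

data Parity : ℕ → Set where
  even : (t : ℕ) → Parity (t + t)
  odd  : (t : ℕ) → Parity (suc (t + t))

parity : (s : ℕ) → Parity s
parity zero = even zero
parity (suc s) with parity s
... | even t = odd t
... | odd t = subst Parity (cong suc (ℕP.+-suc t t)) (even (suc t))

-- ĥ_k(s) and r̂_k(s) as in the paper, for indices s ∈ {0,…,2^k}.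
-- Outside that range the values are an irrelevant default (ĥ = 1, r̂ = 0);
-- on {0,…,2^k} they agree exactly with the paper's recursion:
--   ĥ_0(0)=ĥ_0(1)=1, r̂_0(0)=0, r̂_0(1)=1,
--   ĥ_{k+1}(2s)=ĥ_k(s), ĥ_{k+1}(2s+1)=ĥ_k(s)+ĥ_k(s+1), same for r̂.
hhat : ℕ → ℕ → ℕ
hhat zero s = 1
hhat (suc k) s with parity s
... | even t = hhat k t
... | odd t  = hhat k t + hhat k (suc t)

rhat : ℕ → ℕ → ℕ
rhat zero zero = 0
rhat zero (suc zero) = 1
rhat zero (suc (suc s)) = 0
rhat (suc k) s with parity s
... | even t = rhat k t
... | odd t  = rhat k t + rhat k (suc t)

hhat-pos : ∀ k s → NonZero (hhat k s)
hhat-pos zero s = _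
hhat-pos (suc k) s with parity s
... | even t = hhat-pos k t
... | odd t  = ℕ.>-nonZero (ℕP.<-≤-trans (ℕ.>-nonZero⁻¹ (hhat k t) {{hhat-pos k t}})
                                          (ℕP.m≤m+n (hhat k t) (hhat k (suc t))))

G : ℕ → Set
G k = Vec Bool k

bit : Bool → ℕ
bit false = 0
bit true  = 1

index : ∀ {k} → G k → ℕ
index {zero} [] = 0
index {suc k} (b ∷ σ) = bit b * 2 ^ k + index σ

F : (k : ℕ) → G k → ℚ
F k σ = (+ rhat k (index σ)) / hhat k (index σ)
  where instance _ = hhat-pos k (index σ)

-- σ·τ mod 2 as a Boolean (true = odd)
dot : ∀ {k} → G k → G k → Bool
dot [] [] = false
dot (true ∷ σ) (true ∷ τ) with dot σ τ
... | true  = false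
... | false = true
dot (_ ∷ σ) (_ ∷ τ) = dot σ τ

sgn : Bool → ℚ
sgn false = ℚ.1ℚ
sgn true  = ℚ.-_ ℚ.1ℚ

allG : (k : ℕ) → List (G k)
allG zero = [] ∷ []
allG (suc k) = map (false ∷_) (allG k) ++ map (true ∷_) (allG k)

sumℚ : List ℚ → ℚ
sumℚ [] = 0ℚ
sumℚ (x ∷ xs) = x ℚ.+ sumℚ xs

j : (k : ℕ) → G k → ℚ
j k τ = ℚ.- ((+ 1 / (2 ^ k)) {{ℕP.m^n≢0 2 k}}
              ℚ.* sumℚ (map (λ σ → sgn (dot σ τ) ℚ.* F k σ) (allG k)))

tau0 : (k : ℕ) → G (suc k)
tau0 k = true ∷ replicate k false

-- Write ε_τ(σ) = (-1)^{σ·τ}. In row k+1 the Farey value F(σ) is at most ½ when σ₁ = 0 and at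
-- least ½ when σ₁ = 1, while ε_{τ₀}(σ) = (-1)^{σ₁}; hence ε_{τ₀}(σ)(F(σ) − ½) = −|F(σ) − ½| is
-- at most ε_τ(σ)(F(σ) − ½) for every τ. The character sums Σ_σ ε_τ(σ) are nonnegative and vanish
-- for τ ≠ 0, in particular for τ₀, so summing shows that the Fourier sum Σ_σ ε_τ(σ) F(σ) is
-- minimal at τ₀. It is negative there because F(0) = 0 < ½ makes the bound ε_{τ₀}F ≤ ε_{τ₀}·½
-- strict at σ = 0. As j_k = −2^{−k} times this sum, both claims follow.
module Submission where

open import Defs
open import Data.Nat using (ℕ; suc)
open import Data.Product using (_×_)
open import Data.Rational using (_<_; _≤_; 0ℚ)

open import Algebra.Bundles using (CommutativeMonoid)
open import Data.Bool using (Bool; true; false)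
open import Data.Empty using (⊥-elim)
import Data.Integer as ℤ
import Data.Integer.Properties as ℤP
open import Data.List using (List; []; _∷_; map; _++_)
import Data.List.Properties as ListP
open import Data.Nat as ℕ using (zero; z≤n; s≤s; _^_)
import Data.Nat.Properties as ℕP
open import Data.Product using (_,_; ∃)
open import Data.Rational using (ℚ; 1ℚ; ½; _+_; _*_; -_; _/_; Positive)
open import Data.Rational.Properties
import Data.Rational.Unnormalised as ℚᵘ
import Data.Rational.Unnormalised.Properties as ℚᵘP
open import Data.Vec using ([]; _∷_; replicate)
open import Function using (_∘_)
open import Relation.Binary.PropositionalEquality

open import Algebra.Properties.CommutativeSemigroup
  (CommutativeMonoid.commutativeSemigroup +-0-commutativeMonoid) using (interchange)

double-≤-double : ∀ {m n} → m ℕ.+ m ℕ.≤ n ℕ.+ n → m ℕ.≤ n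
double-≤-double {m} {n} h =
  subst₂ ℕ._≤_ (sym (ℕP.n≡⌊n+n/2⌋ m)) (sym (ℕP.n≡⌊n+n/2⌋ n)) (ℕP.⌊n/2⌋-mono h)

odd-≤-double : ∀ {m n} → suc (m ℕ.+ m) ℕ.≤ n ℕ.+ n → suc m ℕ.≤ n
odd-≤-double {m} {n} h =
  subst₂ ℕ._≤_ (cong suc (sym (ℕP.n≡⌊n+n/2⌋ m))) (sym (ℕP.n≡⌈n+n/2⌉ n)) (ℕP.⌈n/2⌉-mono h)

double-≤-odd : ∀ {m n} → n ℕ.+ n ℕ.≤ suc (m ℕ.+ m) → n ℕ.≤ m
double-≤-odd {m} {n} h =
  subst₂ ℕ._≤_ (sym (ℕP.n≡⌊n+n/2⌋ n)) (sym (ℕP.n≡⌈n+n/2⌉ m)) (ℕP.⌊n/2⌋-mono h)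

2^suc : ∀ k → 2 ^ suc k ≡ 2 ^ k ℕ.+ 2 ^ k
2^suc k = cong (2 ^ k ℕ.+_) (ℕP.+-identityʳ (2 ^ k))

2*rhat≤hhat : ∀ k s → s ℕ.≤ 2 ^ k → 2 ℕ.* rhat (suc k) s ℕ.≤ hhat (suc k) s
2*rhat≤hhat zero zero          _ = z≤n
2*rhat≤hhat zero (suc zero)    _ = ℕP.≤-refl
2*rhat≤hhat zero (suc (suc s)) (s≤s ())
2*rhat≤hhat (suc k) s s≤2^[1+k] with parity s
... | even t = 2*rhat≤hhat k t (double-≤-double (subst (t ℕ.+ t ℕ.≤_) (2^suc k) s≤2^[1+k]))
... | odd t  = begin
  2 ℕ.* (rhat (suc k) t ℕ.+ rhat (suc k) (suc t))       ≡⟨ ℕP.*-distribˡ-+ 2 (rhat (suc k) t) _ ⟩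
  2 ℕ.* rhat (suc k) t ℕ.+ 2 ℕ.* rhat (suc k) (suc t)   ≤⟨ ℕP.+-mono-≤ (2*rhat≤hhat k t (ℕP.<⇒≤ t<2^k))
                                                                      (2*rhat≤hhat k (suc t) t<2^k) ⟩
  hhat (suc k) t ℕ.+ hhat (suc k) (suc t)               ∎
  where
  open ℕP.≤-Reasoning
  t<2^k : t ℕ.< 2 ^ k
  t<2^k = odd-≤-double (subst (suc (t ℕ.+ t) ℕ.≤_) (2^suc k) s≤2^[1+k])

hhat≤2*rhat : ∀ k s → 2 ^ k ℕ.≤ s → s ℕ.≤ 2 ^ suc k → hhat (suc k) s ℕ.≤ 2 ℕ.* rhat (suc k) s
hhat≤2*rhat zero (suc zero)          _ _ = ℕP.≤-refl
hhat≤2*rhat zero (suc (suc zero))    _ _ = s≤s z≤n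
hhat≤2*rhat zero (suc (suc (suc s))) _ (s≤s (s≤s ()))
hhat≤2*rhat (suc k) s 2^[1+k]≤s s≤2^[2+k] with parity s
... | even t = hhat≤2*rhat k t (double-≤-double (subst (ℕ._≤ t ℕ.+ t) (2^suc k) 2^[1+k]≤s))
                               (double-≤-double (subst (t ℕ.+ t ℕ.≤_) (2^suc (suc k)) s≤2^[2+k]))
... | odd t  = begin
  hhat (suc k) t ℕ.+ hhat (suc k) (suc t)               ≤⟨ ℕP.+-mono-≤ (hhat≤2*rhat k t 2^k≤t (ℕP.<⇒≤ t<2^[1+k]))
                                                             (hhat≤2*rhat k (suc t) (ℕP.m≤n⇒m≤1+n 2^k≤t) t<2^[1+k]) ⟩
  2 ℕ.* rhat (suc k) t ℕ.+ 2 ℕ.* rhat (suc k) (suc t)   ≡⟨ ℕP.*-distribˡ-+ 2 (rhat (suc k) t) _ ⟨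
  2 ℕ.* (rhat (suc k) t ℕ.+ rhat (suc k) (suc t))       ∎
  where
  open ℕP.≤-Reasoning
  2^k≤t : 2 ^ k ℕ.≤ t
  2^k≤t = double-≤-odd (subst (ℕ._≤ suc (t ℕ.+ t)) (2^suc k) 2^[1+k]≤s)
  t<2^[1+k] : t ℕ.< 2 ^ suc k
  t<2^[1+k] = odd-≤-double (subst (suc (t ℕ.+ t) ℕ.≤_) (2^suc (suc k)) s≤2^[2+k])

i*n≤j*m⇒i/m≤j/n : ∀ i j m n .{{_ : ℕ.NonZero m}} .{{_ : ℕ.NonZero n}} →
                 i ℤ.* ℤ.+ n ℤ.≤ j ℤ.* ℤ.+ m → i / m ≤ j / n
i*n≤j*m⇒i/m≤j/n i j (suc m) (suc n) h = toℚᵘ-cancel-≤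
  (ℚᵘP.≤-respˡ-≃ (ℚᵘP.≃-sym (toℚᵘ-fromℚᵘ (ℚᵘ.mkℚᵘ i m)))
    (ℚᵘP.≤-respʳ-≃ (ℚᵘP.≃-sym (toℚᵘ-fromℚᵘ (ℚᵘ.mkℚᵘ j n))) (ℚᵘ.*≤* h)))

/-≤-½ : ∀ r h .{{_ : ℕ.NonZero h}} → 2 ℕ.* r ℕ.≤ h → ℤ.+ r / h ≤ ½
/-≤-½ r h 2r≤h = i*n≤j*m⇒i/m≤j/n (ℤ.+ r) (ℤ.+ 1) h 2
  (subst₂ ℤ._≤_ (ℤP.pos-* r 2) (ℤP.pos-* 1 h)
    (ℤ.+≤+ (subst₂ ℕ._≤_ (ℕP.*-comm 2 r) (sym (ℕP.*-identityˡ h)) 2r≤h)))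

½-≤-/ : ∀ r h .{{_ : ℕ.NonZero h}} → h ℕ.≤ 2 ℕ.* r → ½ ≤ ℤ.+ r / h
½-≤-/ r h h≤2r = i*n≤j*m⇒i/m≤j/n (ℤ.+ 1) (ℤ.+ r) 2 h
  (subst₂ ℤ._≤_ (ℤP.pos-* 1 h) (ℤP.pos-* r 2)
    (ℤ.+≤+ (subst₂ ℕ._≤_ (sym (ℕP.*-identityˡ h)) (ℕP.*-comm 2 r) h≤2r)))

index<2^k : ∀ {k} (σ : G k) → index σ ℕ.< 2 ^ k
index<2^k [] = s≤s z≤n
index<2^k {suc k} (false ∷ σ) = ℕP.≤-trans (index<2^k σ) (ℕP.m≤m+n (2 ^ k) _)
index<2^k {suc k} (true ∷ σ) rewrite ℕP.+-identityʳ (2 ^ k) = ℕP.+-monoʳ-< (2 ^ k) (index<2^k σ)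

2^k≤index : ∀ {k} (σ : G k) → 2 ^ k ℕ.≤ index (true ∷ σ)
2^k≤index {k} σ = ℕP.≤-trans (ℕP.m≤m+n (2 ^ k) 0) (ℕP.m≤m+n _ (index σ))

HalfSide : Bool → ℚ → Set
HalfSide false x = x ≤ ½
HalfSide true  x = ½ ≤ x

F-halfSide : ∀ k b (σ : G k) → HalfSide b (F (suc k) (b ∷ σ))
F-halfSide k false σ = /-≤-½ (rhat (suc k) s) (hhat (suc k) s) {{hhat-pos (suc k) s}}
  (2*rhat≤hhat k s (ℕP.<⇒≤ (index<2^k σ)))
  where s = index σ
F-halfSide k true σ = ½-≤-/ (rhat (suc k) s) (hhat (suc k) s) {{hhat-pos (suc k) s}}
  (hhat≤2*rhat k s (2^k≤index σ) (ℕP.<⇒≤ (index<2^k (true ∷ σ))))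
  where s = index (true ∷ σ)

sgn-true-* : ∀ x → sgn true * x ≡ - x
sgn-true-* x = trans (sym (neg-distribˡ-* 1ℚ x)) (cong -_ (*-identityˡ x))

halfSide-bound : ∀ b {x} → HalfSide b x → sgn b * x ≤ sgn b * ½
halfSide-bound false {x} x≤½ rewrite *-identityˡ x = x≤½
halfSide-bound true  {x} ½≤x rewrite sgn-true-* x = neg-antimono-≤ ½≤x

-- ε_b (x − ½) ≤ ε_e (x − ½), with the ½-terms moved across so that no subtraction occurs.
halfSide-rearrange : ∀ b {x} → HalfSide b x → ∀ e →
                     sgn b * x + sgn e * ½ ≤ sgn e * x + sgn b * ½
halfSide-rearrange false x≤½ false = ≤-refl
halfSide-rearrange true  ½≤x true  = ≤-refl
-- ≤-trans typechecks because the closed terms ½ + - ½ and - ½ + ½ both compute to 0ℚ.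
halfSide-rearrange false {x} x≤½ true rewrite *-identityˡ x | sgn-true-* x =
  ≤-trans (+-monoˡ-≤ (- ½) x≤½) (+-monoˡ-≤ ½ (neg-antimono-≤ x≤½))
halfSide-rearrange true  {x} ½≤x false rewrite *-identityˡ x | sgn-true-* x =
  ≤-trans (+-monoˡ-≤ ½ (neg-antimono-≤ ½≤x)) (+-monoˡ-≤ (- ½) ½≤x)

sumℚ-++ : (xs ys : List ℚ) → sumℚ (xs ++ ys) ≡ sumℚ xs + sumℚ ys
sumℚ-++ []       ys = sym (+-identityˡ (sumℚ ys))
sumℚ-++ (x ∷ xs) ys = trans (cong (x +_) (sumℚ-++ xs ys)) (sym (+-assoc x (sumℚ xs) (sumℚ ys)))

module _ {A : Set} where

  sumℚ-map-mono : {f g : A → ℚ} → (∀ x → f x ≤ g x) → ∀ xs → sumℚ (map f xs) ≤ sumℚ (map g xs)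
  sumℚ-map-mono f≤g []       = ≤-refl
  sumℚ-map-mono f≤g (x ∷ xs) = +-mono-≤ (f≤g x) (sumℚ-map-mono f≤g xs)

  sumℚ-map-+ : (f g : A → ℚ) → ∀ xs →
               sumℚ (map (λ x → f x + g x) xs) ≡ sumℚ (map f xs) + sumℚ (map g xs)
  sumℚ-map-+ f g []       = refl
  sumℚ-map-+ f g (x ∷ xs) =
    trans (cong (f x + g x +_) (sumℚ-map-+ f g xs)) (interchange (f x) (g x) _ _)

  sumℚ-map-*ʳ : (f : A → ℚ) (c : ℚ) → ∀ xs → sumℚ (map (λ x → f x * c) xs) ≡ sumℚ (map f xs) * c
  sumℚ-map-*ʳ f c []       = sym (*-zeroˡ c)
  sumℚ-map-*ʳ f c (x ∷ xs) =
    trans (cong (f x * c +_) (sumℚ-map-*ʳ f c xs)) (sym (*-distribʳ-+ c (f x) _))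

  sumℚ-map-neg : (f : A → ℚ) → ∀ xs → sumℚ (map (λ x → - f x) xs) ≡ - sumℚ (map f xs)
  sumℚ-map-neg f []       = refl
  sumℚ-map-neg f (x ∷ xs) =
    trans (cong (- f x +_) (sumℚ-map-neg f xs)) (sym (neg-distrib-+ (f x) _))

sumℚ-allG-suc : ∀ k (f : G (suc k) → ℚ) →
                sumℚ (map f (allG (suc k))) ≡
                sumℚ (map (λ σ → f (false ∷ σ)) (allG k)) + sumℚ (map (λ σ → f (true ∷ σ)) (allG k))
sumℚ-allG-suc k f = begin
  sumℚ (map f (map (false ∷_) (allG k) ++ map (true ∷_) (allG k)))
    ≡⟨ cong sumℚ (ListP.map-++ f (map (false ∷_) (allG k)) _) ⟩
  sumℚ (map f (map (false ∷_) (allG k)) ++ map f (map (true ∷_) (allG k)))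
    ≡⟨ sumℚ-++ (map f (map (false ∷_) (allG k))) _ ⟩
  sumℚ (map f (map (false ∷_) (allG k))) + sumℚ (map f (map (true ∷_) (allG k)))
    ≡⟨ cong₂ (λ xs ys → sumℚ xs + sumℚ ys) (ListP.map-∘ {g = f} (allG k)) (ListP.map-∘ {g = f} (allG k)) ⟨
  sumℚ (map (λ σ → f (false ∷ σ)) (allG k)) + sumℚ (map (λ σ → f (true ∷ σ)) (allG k)) ∎
  where open ≡-Reasoning

allG-head : ∀ k → ∃ λ rest → allG k ≡ replicate k false ∷ rest
allG-head zero = [] , refl
allG-head (suc k) with allG-head k
... | rest , eq rewrite eq = _ , refl

dot-zeroʳ : ∀ {k} (σ : G k) → dot σ (replicate k false) ≡ false
dot-zeroʳ []          = refl
dot-zeroʳ (false ∷ σ) = dot-zeroʳ σ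
dot-zeroʳ (true ∷ σ)  = dot-zeroʳ σ

dot-tau0 : ∀ {k} b (σ : G k) → dot (b ∷ σ) (tau0 k) ≡ b
dot-tau0 false σ = dot-zeroʳ σ
dot-tau0 true  σ rewrite dot-zeroʳ σ = refl

sgn-dot-true-true : ∀ {k} (σ τ : G k) → sgn (dot (true ∷ σ) (true ∷ τ)) ≡ - sgn (dot σ τ)
sgn-dot-true-true σ τ with dot σ τ
... | true  = refl
... | false = refl

characterSum : ∀ k → G k → ℚ
characterSum k τ = sumℚ (map (λ σ → sgn (dot σ τ)) (allG k))

characterSum-≡0 : ∀ k (τ : G k) → τ ≢ replicate k false → characterSum k τ ≡ 0ℚ
characterSum-≡0 zero    []          τ≢0 = ⊥-elim (τ≢0 refl)
characterSum-≡0 (suc k) (false ∷ τ) τ≢0 = begin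
  characterSum (suc k) (false ∷ τ)        ≡⟨ sumℚ-allG-suc k (λ σ → sgn (dot σ (false ∷ τ))) ⟩
  characterSum k τ + characterSum k τ     ≡⟨ cong₂ _+_ χτ≡0 χτ≡0 ⟩
  0ℚ                                      ∎
  where
  open ≡-Reasoning
  χτ≡0 : characterSum k τ ≡ 0ℚ
  χτ≡0 = characterSum-≡0 k τ (τ≢0 ∘ cong (false ∷_))
characterSum-≡0 (suc k) (true ∷ τ)  _   = begin
  characterSum (suc k) (true ∷ τ)
    ≡⟨ sumℚ-allG-suc k (λ σ → sgn (dot σ (true ∷ τ))) ⟩
  characterSum k τ + sumℚ (map (λ σ → sgn (dot (true ∷ σ) (true ∷ τ))) (allG k))
    ≡⟨ cong (characterSum k τ +_) (cong sumℚ (ListP.map-cong (λ σ → sgn-dot-true-true σ τ) (allG k))) ⟩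
  characterSum k τ + sumℚ (map (λ σ → - sgn (dot σ τ)) (allG k))
    ≡⟨ cong (characterSum k τ +_) (sumℚ-map-neg (λ σ → sgn (dot σ τ)) (allG k)) ⟩
  characterSum k τ + - characterSum k τ
    ≡⟨ +-inverseʳ (characterSum k τ) ⟩
  0ℚ ∎
  where open ≡-Reasoning

characterSum-nonneg : ∀ k (τ : G k) → 0ℚ ≤ characterSum k τ
characterSum-nonneg zero    []          = ≤ᵇ⇒≤ _
characterSum-nonneg (suc k) (false ∷ τ) =
  ≤-trans (+-mono-≤ (characterSum-nonneg k τ) (characterSum-nonneg k τ))
          (≤-reflexive (sym (sumℚ-allG-suc k (λ σ → sgn (dot σ (false ∷ τ))))))
characterSum-nonneg (suc k) (true ∷ τ)  =
  ≤-reflexive (sym (characterSum-≡0 (suc k) (true ∷ τ) λ ()))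

fourierSum : ∀ k → G k → ℚ
fourierSum k τ = sumℚ (map (λ σ → sgn (dot σ τ) * F k σ) (allG k))

index-zero : ∀ k → index (replicate k false) ≡ 0
index-zero zero    = refl
index-zero (suc k) = index-zero k

rhat-zero : ∀ k → rhat k 0 ≡ 0
rhat-zero zero    = refl
rhat-zero (suc k) = rhat-zero k

F-zero : ∀ k → F k (replicate k false) ≡ 0ℚ
F-zero k rewrite index-zero k | rhat-zero k = 0/n≡0 (hhat k 0) {{hhat-pos k 0}}

module _ (n : ℕ) where
  private
    τ₀ : G (suc n)
    τ₀ = tau0 n

    Σ : (G (suc n) → ℚ) → ℚ
    Σ f = sumℚ (map f (allG (suc n)))

    signedF signedHalf : G (suc n) → G (suc n) → ℚ
    signedF    τ σ = sgn (dot σ τ) * F (suc n) σ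
    signedHalf τ σ = sgn (dot σ τ) * ½

    Σ-signedHalf : ∀ τ → Σ (signedHalf τ) ≡ characterSum (suc n) τ * ½
    Σ-signedHalf τ = sumℚ-map-*ʳ (λ σ → sgn (dot σ τ)) ½ (allG (suc n))

    Σ-signedHalf-τ₀ : Σ (signedHalf τ₀) ≡ 0ℚ
    Σ-signedHalf-τ₀ = trans (Σ-signedHalf τ₀) (cong (_* ½) (characterSum-≡0 (suc n) τ₀ λ ()))

    Σ-signedHalf-nonneg : ∀ τ → 0ℚ ≤ Σ (signedHalf τ)
    Σ-signedHalf-nonneg τ = ≤-trans (*-monoʳ-≤-nonNeg ½ (characterSum-nonneg (suc n) τ))
                                    (≤-reflexive (sym (Σ-signedHalf τ)))

    signedF-τ₀-bound : ∀ σ → signedF τ₀ σ ≤ signedHalf τ₀ σ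
    signedF-τ₀-bound (b ∷ σ) rewrite dot-tau0 b σ = halfSide-bound b (F-halfSide n b σ)

    signedF-τ₀-rearrange : ∀ τ σ → signedF τ₀ σ + signedHalf τ σ ≤ signedF τ σ + signedHalf τ₀ σ
    signedF-τ₀-rearrange τ (b ∷ σ) rewrite dot-tau0 b σ =
      halfSide-rearrange b (F-halfSide n b σ) (dot (b ∷ σ) τ)

  fourierSum-tau0-minimal : ∀ τ → fourierSum (suc n) τ₀ ≤ fourierSum (suc n) τ
  fourierSum-tau0-minimal τ = begin
    Σ (signedF τ₀)                                      ≡⟨ +-identityʳ (Σ (signedF τ₀)) ⟨
    Σ (signedF τ₀) + 0ℚ                                 ≤⟨ +-monoʳ-≤ (Σ (signedF τ₀)) (Σ-signedHalf-nonneg τ) ⟩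
    Σ (signedF τ₀) + Σ (signedHalf τ)                   ≡⟨ sumℚ-map-+ (signedF τ₀) (signedHalf τ) (allG (suc n)) ⟨
    Σ (λ σ → signedF τ₀ σ + signedHalf τ σ)             ≤⟨ sumℚ-map-mono (signedF-τ₀-rearrange τ) (allG (suc n)) ⟩
    Σ (λ σ → signedF τ σ + signedHalf τ₀ σ)             ≡⟨ sumℚ-map-+ (signedF τ) (signedHalf τ₀) (allG (suc n)) ⟩
    Σ (signedF τ) + Σ (signedHalf τ₀)                   ≡⟨ cong (Σ (signedF τ) +_) Σ-signedHalf-τ₀ ⟩
    Σ (signedF τ) + 0ℚ                                  ≡⟨ +-identityʳ (Σ (signedF τ)) ⟩
    Σ (signedF τ)                                       ∎
    where open ≤-Reasoning

  fourierSum-tau0-negative : fourierSum (suc n) τ₀ < 0ℚ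
  fourierSum-tau0-negative with allG-head (suc n)
  ... | σs , allG≡0∷σs = begin-strict
    Σ (signedF τ₀)                                      ≡⟨ cong (sumℚ ∘ map (signedF τ₀)) allG≡0∷σs ⟩
    signedF τ₀ 0ᴳ + sumℚ (map (signedF τ₀) σs)          <⟨ +-mono-<-≤ signedF-τ₀-0ᴳ (sumℚ-map-mono signedF-τ₀-bound σs) ⟩
    signedHalf τ₀ 0ᴳ + sumℚ (map (signedHalf τ₀) σs)    ≡⟨ cong (sumℚ ∘ map (signedHalf τ₀)) allG≡0∷σs ⟨
    Σ (signedHalf τ₀)                                   ≡⟨ Σ-signedHalf-τ₀ ⟩
    0ℚ                                                  ∎
    where
    open ≤-Reasoning
    0ᴳ : G (suc n)
    0ᴳ = replicate (suc n) false

    signedF-τ₀-0ᴳ : signedF τ₀ 0ᴳ < signedHalf τ₀ 0ᴳ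
    signedF-τ₀-0ᴳ rewrite dot-tau0 false (replicate n false) | F-zero (suc n) = positive⁻¹ ½

module _ (k : ℕ) where
  private
    2⁻ᵏ : ℚ
    2⁻ᵏ = (ℤ.+ 1 / 2 ^ k) {{ℕP.m^n≢0 2 k}}

    instance
      2⁻ᵏ-pos : Positive 2⁻ᵏ
      2⁻ᵏ-pos = normalize-pos 1 (2 ^ k) {{ℕP.m^n≢0 2 k}}

  j-positive : ∀ {τ} → fourierSum k τ < 0ℚ → 0ℚ < j k τ
  j-positive {τ} S<0 = neg-antimono-<
    (subst (2⁻ᵏ * fourierSum k τ <_) (*-zeroʳ 2⁻ᵏ) (*-monoʳ-<-pos 2⁻ᵏ S<0))

  j-antitone : ∀ {τ τ′} → fourierSum k τ ≤ fourierSum k τ′ → j k τ′ ≤ j k τ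
  j-antitone S≤S′ = neg-antimono-≤ (*-monoˡ-≤-nonNeg 2⁻ᵏ {{pos⇒nonNeg 2⁻ᵏ}} S≤S′)

proposition4p4 : (n : ℕ) →
    (0ℚ < j (suc n) (tau0 n)) × ((τ : G (suc n)) → j (suc n) τ ≤ j (suc n) (tau0 n))
proposition4p4 n =
  j-positive (suc n) (fourierSum-tau0-negative n) ,
  λ τ → j-antitone (suc n) (fourierSum-tau0-minimal n τ)
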